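{- Let $p\geq 3$ be an integer. The maximum number of edges of a (simple) graph on $p$ vertices satisfying the $(p,3)$-property equals $\binom{p-1}{2}+1$.
   Context: A graph satisfies the $(p,3)$-property if among any $p$ of its edges some $3$ of them have a common vertex (a graph with fewer than $p$ edges satisfies it vacuously). Equivalently, the graph contains no subgraph with exactly $p$ edges, no isolated vertices and maximum degree at most $2$. -}

module Defs where

open import Data.Nat using (ℕ; zero; suc; _≤_)
open import Data.Fin using (Fin; _<_)
open import Data.Fin.Properties using (_≟_)
open import Data.Product using (_×_; _,_; proj₁; proj₂; ∃)
open import Data.List using (List; []; _∷_; length)
open import Data.List.Relation.Unary.All using (All)
open import Data.List.Relation.Unary.Unique.Propositional using (Unique)
open import Data.List.Relation.Binary.Subset.Propositional using (_⊆_)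
open import Relation.Binary.PropositionalEquality using (_≡_)
open import Relation.Nullary using (yes; no)

-- An edge {u,v} on vertex set Fin p is stored canonically as (u , v) with u < v.
Edge : ℕ → Set
Edge p = Fin p × Fin p

-- A finite simple graph on vertex set Fin p: a duplicate-free list of
-- canonical edges (no loops since u < v; no multi-edges by uniqueness).
record Graph (p : ℕ) : Set where
  field
    edges    : List (Edge p)
    ordered  : All (λ e → proj₁ e < proj₂ e) edges
    distinct : Unique edges
open Graph public

numEdges : ∀ {p} → Graph p → ℕ
numEdges G = length (edges G)

deg : ∀ {p} → Fin p → List (Edge p) → ℕ
deg v [] = zero
deg v ((a , b) ∷ es) with v ≟ a | v ≟ b
... | yes _ | _     = suc (deg v es)
... | no _  | yes _ = suc (deg v es)
... | no _  | no _  = deg v es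

HasProperty3 : ∀ {p} → ℕ → Graph p → Set
HasProperty3 q G =
  (S : List (Edge _)) → Unique S → S ⊆ edges G → length S ≡ q →
  ∃ λ v → 3 ≤ deg v S

-- The extremal graph is K_{p-1} plus one pendant edge: p of its edges have degree sum 2p,
-- while without a vertex of degree 3 the pendant vertex contributes at most 1 and every
-- other vertex at most 2. For the upper bound, a graph on p ≥ 3 vertices with at least
-- C(p-1,2) + 2 edges has a Hamilton cycle (Ore), whose p edges have maximum degree 2.
-- Hamiltonicity goes by induction on p. A complete graph is Hamiltonian; otherwise two
-- nonadjacent vertices have degree sum at least p, since at most C(p-2,2) edges avoid
-- them. The one of larger degree d then satisfies p/2 ≤ d ≤ p-2, so deleting it leaves
-- enough edges for the induction hypothesis, and as d > (p-1)/2 it is adjacent to two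
-- consecutive vertices of that cycle and can be inserted between them.
module Submission where

open import Defs
open import Data.Nat using (ℕ; zero; suc; _+_; _*_; _∸_; _≤_; _<_; z≤n; s≤s; _≤?_)
open import Data.Fin using (Fin; zero; suc) renaming (_<_ to _<ᶠ_)
import Data.Fin.Properties as Fin
open import Data.Nat.Properties
open import Data.Nat.Tactic.RingSolver using (solve-∀)
open import Data.Nat.Combinatorics using (_C_; nC1≡n; nCk+nC[k+1]≡[n+1]C[k+1])
open import Data.List using (List; []; _∷_; _++_; [_]; length; map; cartesianProduct; allFin; tabulate)
open import Data.List.Relation.Binary.Disjoint.Propositional using (Disjoint)
open import Data.List.Properties using (length-++; length-map; map-++; map-∘; length-tabulate)
open import Data.List.Membership.Propositional using (_∈_; _∉_; find; lose)
open import Data.List.Membership.Propositional.Properties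
  using (∈-∃++; ∈-allFin; ∈-cartesianProduct⁺; ∈-map⁻; ∈-tabulate⁻)
import Data.List.Membership.DecPropositional as DecMembership
open import Data.List.Relation.Unary.Any using (here; there; any?)
open import Data.List.Relation.Unary.All as All using (All; _∷_)
import Data.List.Relation.Unary.All.Properties as All
open import Data.List.Relation.Unary.All.Properties using (¬Any⇒All¬)
open import Data.List.Relation.Unary.Linked using (Linked; [-]; _∷_)
open import Data.List.Relation.Unary.Unique.Propositional using (Unique; []; _∷_)
open import Data.List.Relation.Unary.Unique.Propositional.Properties
  using (Unique[x∷xs]⇒x∉xs; allFin⁺; cartesianProduct⁺)
import Data.List.Relation.Unary.Unique.Propositional.Properties as Unique
open import Data.List.Relation.Binary.Subset.Propositional using (_⊆_)
open import Data.List.Relation.Binary.Permutation.Propositional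
  using (_↭_; ↭-refl; ↭-sym; ↭-trans; ↭-prep; ↭-swap; ↭⇒↭ₛ)
open import Data.List.Relation.Binary.Permutation.Propositional.Properties
  using (shift; map⁺; ∷↭∷ʳ; ↭-length; ∈-resp-↭)
import Data.List.Relation.Binary.Permutation.Setoid.Properties as SetoidPermutation
open import Data.Nat.ListAction using (sum)
open import Data.Nat.ListAction.Properties using (sum-++; sum-↭)
open import Data.Product using (Σ; _×_; _,_; proj₁; proj₂; ∃; ∃₂; swap)
open import Data.Product.Properties using (,-injective; ≡-dec)
open import Data.Sum as Sum using (_⊎_; inj₁; inj₂)
open import Data.Empty using (⊥-elim)
open import Relation.Nullary using (Dec; yes; no; ¬_)
open import Relation.Nullary.Decidable using (_⊎-dec_; _×-dec_; ¬?)
open import Relation.Binary.Definitions using (DecidableEquality)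
open import Relation.Binary.PropositionalEquality
  using (_≡_; _≢_; refl; sym; trans; cong; cong₂; subst; subst₂; setoid; module ≡-Reasoning)

private
  variable
    A B : Set
    P Q : Set
    x y : A
    xs ys : List A
    f g : A → ℕ

𝟙 : Dec P → ℕ
𝟙 (yes _) = 1
𝟙 (no _)  = 0

𝟙≤1 : (d : Dec P) → 𝟙 d ≤ 1
𝟙≤1 (yes _) = s≤s z≤n
𝟙≤1 (no _)  = z≤n

𝟙-yes : (d : Dec P) → P → 𝟙 d ≡ 1
𝟙-yes (yes _) _ = refl
𝟙-yes (no ¬p) p = ⊥-elim (¬p p)

𝟙-no : (d : Dec P) → ¬ P → 𝟙 d ≡ 0
𝟙-no (yes p) ¬p = ⊥-elim (¬p p)
𝟙-no (no _)  _  = refl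

𝟙-⇔ : (d : Dec P) (d′ : Dec Q) → (P → Q) → (Q → P) → 𝟙 d ≡ 𝟙 d′
𝟙-⇔ (yes p) d′ to _    = sym (𝟙-yes d′ (to p))
𝟙-⇔ (no ¬p) d′ _  from = sym (𝟙-no d′ (λ q → ¬p (from q)))

𝟙-⊎ : (d : Dec P) (d′ : Dec Q) → ¬ (P × Q) → 𝟙 d + 𝟙 d′ ≡ 𝟙 (d ⊎-dec d′)
𝟙-⊎ (yes p) (yes q) ¬both = ⊥-elim (¬both (p , q))
𝟙-⊎ (yes _) (no _)  _     = refl
𝟙-⊎ (no _)  (yes _) _     = refl
𝟙-⊎ (no _)  (no _)  _     = refl

∑ : List A → (A → ℕ) → ℕ
∑ xs f = sum (map f xs)

syntax ∑ xs (λ x → e) = ∑[ x ∈ xs ] e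

∑-cong : ∀ xs → (∀ {x} → x ∈ xs → f x ≡ g x) → ∑ xs f ≡ ∑ xs g
∑-cong []       _   = refl
∑-cong (x ∷ xs) f≡g = cong₂ _+_ (f≡g (here refl)) (∑-cong xs (λ x∈ → f≡g (there x∈)))

∑-mono : ∀ xs → (∀ {x} → x ∈ xs → f x ≤ g x) → ∑ xs f ≤ ∑ xs g
∑-mono []       _   = z≤n
∑-mono (x ∷ xs) f≤g = +-mono-≤ (f≤g (here refl)) (∑-mono xs (λ x∈ → f≤g (there x∈)))

∑-zero : ∀ (xs : List A) → ∑[ x ∈ xs ] 0 ≡ 0
∑-zero []       = refl
∑-zero (_ ∷ xs) = ∑-zero xs

∑-const : ∀ (xs : List A) c → ∑[ x ∈ xs ] c ≡ length xs * c
∑-const []       c = refl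
∑-const (_ ∷ xs) c = cong (c +_) (∑-const xs c)

∑-+ : ∀ xs → ∑[ x ∈ xs ] (f x + g x) ≡ ∑ xs f + ∑ xs g
∑-+             []       = refl
∑-+ {f = f} {g} (x ∷ xs) = trans (cong (f x + g x +_) (∑-+ xs)) (+-+-comm (f x) (g x) _ _)
  where
  +-+-comm : ∀ a b c d → a + b + (c + d) ≡ a + c + (b + d)
  +-+-comm = solve-∀

∑-++ : ∀ xs ys → ∑ (xs ++ ys) f ≡ ∑ xs f + ∑ ys f
∑-++ {f = f} xs ys = trans (cong sum (map-++ f xs ys)) (sum-++ (map f xs) (map f ys))

∑-map : ∀ (h : B → A) xs → ∑ (map h xs) f ≡ ∑[ x ∈ xs ] f (h x)
∑-map h xs = cong sum (sym (map-∘ xs))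

∑-↭ : xs ↭ ys → ∑ xs f ≡ ∑ ys f
∑-↭ {f = f} xs↭ys = sum-↭ (map⁺ f xs↭ys)

∑-swap : ∀ (h : A → B → ℕ) xs ys →
         ∑[ x ∈ xs ] ∑[ y ∈ ys ] h x y ≡ ∑[ y ∈ ys ] ∑[ x ∈ xs ] h x y
∑-swap h []       ys = sym (∑-zero ys)
∑-swap h (x ∷ xs) ys = trans (cong (∑ ys (h x) +_) (∑-swap h xs ys)) (sym (∑-+ ys))

∑-cartesianProduct : ∀ (h : A × B → ℕ) xs ys →
  ∑ (cartesianProduct xs ys) h ≡ ∑[ x ∈ xs ] ∑[ y ∈ ys ] h (x , y)
∑-cartesianProduct h []       ys = refl
∑-cartesianProduct h (x ∷ xs) ys =
  trans (∑-++ (map (x ,_) ys) (cartesianProduct xs ys))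
        (cong₂ _+_ (∑-map (x ,_) ys) (∑-cartesianProduct h xs ys))

∈⇒∷↭ : x ∈ xs → ∃ λ ys → x ∷ ys ↭ xs
∈⇒∷↭ x∈xs with ys , zs , refl ← ∈-∃++ x∈xs = ys ++ zs , ↭-sym (shift _ ys zs)

Unique-resp-↭ : xs ↭ ys → Unique xs → Unique ys
Unique-resp-↭ xs↭ys = SetoidPermutation.Unique-resp-↭ (setoid _) (↭⇒↭ₛ xs↭ys)

∈₂⇒∷∷↭ : x ∈ xs → y ∈ xs → x ≢ y → ∃ λ zs → x ∷ y ∷ zs ↭ xs
∈₂⇒∷∷↭ x∈ y∈ x≢y with ys , x∷ys↭ ← ∈⇒∷↭ x∈ with ∈-resp-↭ (↭-sym x∷ys↭) y∈
... | here y≡x   = ⊥-elim (x≢y (sym y≡x))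
... | there y∈ys with zs , y∷zs↭ys ← ∈⇒∷↭ y∈ys = zs , ↭-trans (↭-prep _ y∷zs↭ys) x∷ys↭

n≤m⇒m+n≤2*m : ∀ {m n} → n ≤ m → m + n ≤ 2 * m
n≤m⇒m+n≤2*m {m} n≤m = +-monoʳ-≤ m (≤-trans n≤m (≤-reflexive (sym (+-identityʳ m))))

module Counting {A : Set} (_≟_ : DecidableEquality A) where

  open DecMembership _≟_ using (_∈?_)

  occurrences : A → List A → ℕ
  occurrences a xs = ∑[ y ∈ xs ] 𝟙 (a ≟ y)

  occurrences-∉ : ∀ {a} xs → a ∉ xs → occurrences a xs ≡ 0
  occurrences-∉         []       _   = refl
  occurrences-∉ {a = a} (y ∷ xs) a∉ with a ≟ y
  ... | yes refl = ⊥-elim (a∉ (here refl))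
  ... | no _     = occurrences-∉ xs (λ a∈ → a∉ (there a∈))

  occurrences-unique : ∀ {a xs} → Unique xs → a ∈ xs → occurrences a xs ≡ 1
  occurrences-unique {a} {y ∷ xs} unique@(_ ∷ unique′) a∈ with a ≟ y | a∈
  ... | yes refl | _          = cong suc (occurrences-∉ xs (Unique[x∷xs]⇒x∉xs unique))
  ... | no a≢y   | here a≡y   = ⊥-elim (a≢y a≡y)
  ... | no _     | there a∈xs = occurrences-unique unique′ a∈xs

  𝟙-∈-∷ : ∀ {y ys} z → y ∉ ys → 𝟙 (z ∈? y ∷ ys) ≡ 𝟙 (y ≟ z) + 𝟙 (z ∈? ys)
  𝟙-∈-∷ {y} {ys} z y∉ with y ≟ z
  ... | yes refl = trans (𝟙-yes (z ∈? z ∷ ys) (here refl)) (cong suc (sym (𝟙-no (z ∈? ys) y∉)))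
  ... | no y≢z   = 𝟙-⇔ (z ∈? y ∷ ys) (z ∈? ys) from-tail there
    where
    from-tail : z ∈ y ∷ ys → z ∈ ys
    from-tail (here z≡y) = ⊥-elim (y≢z (sym z≡y))
    from-tail (there z∈) = z∈

  ∑𝟙∈≡length : ∀ xs {ys} → Unique xs → Unique ys → ys ⊆ xs → ∑[ z ∈ xs ] 𝟙 (z ∈? ys) ≡ length ys
  ∑𝟙∈≡length xs {[]}     _   _        _     = trans (∑-cong xs (λ {z} _ → 𝟙-no (z ∈? []) λ ())) (∑-zero xs)
  ∑𝟙∈≡length xs {y ∷ ys} uxs uy∷ys@(_ ∷ uys) ys⊆xs = begin
    ∑[ z ∈ xs ] 𝟙 (z ∈? y ∷ ys)                ≡⟨ ∑-cong xs (λ {z} _ → 𝟙-∈-∷ z (Unique[x∷xs]⇒x∉xs uy∷ys)) ⟩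
    ∑[ z ∈ xs ] (𝟙 (y ≟ z) + 𝟙 (z ∈? ys))      ≡⟨ ∑-+ xs ⟩
    occurrences y xs + ∑[ z ∈ xs ] 𝟙 (z ∈? ys) ≡⟨ cong₂ _+_ (occurrences-unique uxs (ys⊆xs (here refl)))
                                                            (∑𝟙∈≡length xs uxs uys (λ z∈ → ys⊆xs (there z∈))) ⟩
    suc (length ys)                            ∎
    where open ≡-Reasoning

-- Ore's theorem for a decidable symmetric irreflexive relation on a list of vertices

module Hamiltonicity
  {A : Set} (_≟_ : DecidableEquality A)
  {Adj : A → A → Set} (adj? : ∀ x y → Dec (Adj x y))
  (adj-sym : ∀ {x y} → Adj x y → Adj y x) (adj-irrefl : ∀ {x} → ¬ Adj x x)
  where

  private
    variable
      u v w : A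
      U V W : List A

  degreeIn : A → List A → ℕ
  degreeIn x V = ∑[ y ∈ V ] 𝟙 (adj? x y)

  -- Each edge inside V is counted once from each end.
  adjacentPairs : List A → ℕ
  adjacentPairs V = ∑[ x ∈ V ] degreeIn x V

  record HamiltonCycle (V : List A) : Set where
    constructor cycle
    field
      start  : A
      route  : List A
      spans  : start ∷ route ↭ V
      closed : Linked Adj (start ∷ route ++ [ start ])

  HamiltonCycle-resp-↭ : V ↭ W → HamiltonCycle V → HamiltonCycle W
  HamiltonCycle-resp-↭ V↭W (cycle x xs spans closed) = cycle x xs (↭-trans spans V↭W) closed

  degreeIn-↭ : V ↭ W → degreeIn v V ≡ degreeIn v W
  degreeIn-↭ = ∑-↭

  degreeIn-self : ∀ v W → degreeIn v (v ∷ W) ≡ degreeIn v W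
  degreeIn-self v W = cong (_+ degreeIn v W) (𝟙-no (adj? v v) adj-irrefl)

  degreeIn-nonadjacent : ∀ W → ¬ Adj v w → degreeIn v (w ∷ W) ≡ degreeIn v W
  degreeIn-nonadjacent {v} {w} W ¬vw = cong (_+ degreeIn v W) (𝟙-no (adj? v w) ¬vw)

  degreeIn≤length : ∀ v V → degreeIn v V ≤ length V
  degreeIn≤length v V = begin
    degreeIn v V     ≤⟨ ∑-mono V (λ {y} _ → 𝟙≤1 (adj? v y)) ⟩
    ∑[ y ∈ V ] 1     ≡⟨ ∑-const V 1 ⟩
    length V * 1     ≡⟨ *-identityʳ (length V) ⟩
    length V         ∎
    where open ≤-Reasoning

  adjacentPairs-↭ : V ↭ W → adjacentPairs V ≡ adjacentPairs W
  adjacentPairs-↭ {V} V↭W = trans (∑-cong V (λ _ → degreeIn-↭ V↭W)) (∑-↭ V↭W)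

  adjacentPairs-∷ : ∀ v W → adjacentPairs (v ∷ W) ≡ 2 * degreeIn v W + adjacentPairs W
  adjacentPairs-∷ v W = begin
    degreeIn v (v ∷ W) + ∑[ x ∈ W ] (𝟙 (adj? x v) + degreeIn x W)
      ≡⟨ cong₂ _+_ (degreeIn-self v W) (∑-+ W) ⟩
    degreeIn v W + (∑[ x ∈ W ] 𝟙 (adj? x v) + adjacentPairs W)
      ≡⟨ cong (λ d → degreeIn v W + (d + adjacentPairs W))
              (∑-cong W (λ {x} _ → 𝟙-⇔ (adj? x v) (adj? v x) adj-sym adj-sym)) ⟩
    degreeIn v W + (degreeIn v W + adjacentPairs W)
      ≡⟨ double (degreeIn v W) (adjacentPairs W) ⟩
    2 * degreeIn v W + adjacentPairs W ∎
    where
    open ≡-Reasoning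
    double : ∀ d p → d + (d + p) ≡ 2 * d + p
    double = solve-∀

  adjacentPairs+length≤length² : ∀ V → adjacentPairs V + length V ≤ length V * length V
  adjacentPairs+length≤length² []      = z≤n
  adjacentPairs+length≤length² (v ∷ W) = begin
    adjacentPairs (v ∷ W) + suc n             ≡⟨ cong (_+ suc n) (adjacentPairs-∷ v W) ⟩
    2 * degreeIn v W + adjacentPairs W + suc n ≡⟨ regroup (degreeIn v W) (adjacentPairs W) n ⟩
    2 * degreeIn v W + (adjacentPairs W + n) + 1
      ≤⟨ +-monoˡ-≤ 1 (+-mono-≤ (*-monoʳ-≤ 2 (degreeIn≤length v W)) (adjacentPairs+length≤length² W)) ⟩
    2 * n + n * n + 1                          ≡⟨ square n ⟩
    suc n * suc n                              ∎
    where
    open ≤-Reasoning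
    n = length W
    regroup : ∀ d p n → 2 * d + p + suc n ≡ 2 * d + (p + n) + 1
    regroup = solve-∀
    square : ∀ n → 2 * n + n * n + 1 ≡ suc n * suc n
    square = solve-∀

  adjacentToBoth⊎atMostOne : ∀ v a b → (Adj v a × Adj v b) ⊎ (𝟙 (adj? v a) + 𝟙 (adj? v b) ≤ 1)
  adjacentToBoth⊎atMostOne v a b with adj? v a | adj? v b
  ... | yes va | yes vb = inj₁ (va , vb)
  ... | yes _  | no _   = inj₂ ≤-refl
  ... | no _   | yes _  = inj₂ ≤-refl
  ... | no _   | no _   = inj₂ z≤n

  -- Pigeonhole: if v is adjacent to no two consecutive vertices of the path a, r, z, then each
  -- of its 1 + length r steps meets at most one neighbour of v.
  insertInPath⊎sparse : ∀ v a r z → Linked Adj (a ∷ r ++ [ z ]) →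
    (∃ λ r′ → r′ ↭ v ∷ r × Linked Adj (a ∷ r′ ++ [ z ]))
    ⊎ (2 * degreeIn v r + 𝟙 (adj? v a) + 𝟙 (adj? v z) ≤ suc (length r))
  insertInPath⊎sparse v a [] z az with adjacentToBoth⊎atMostOne v a z
  ... | inj₁ (va , vz) = inj₁ ([ v ] , ↭-refl , adj-sym va ∷ vz ∷ [-])
  ... | inj₂ atMostOne = inj₂ atMostOne
  insertInPath⊎sparse v a (b ∷ r) z (ab ∷ path) with insertInPath⊎sparse v b r z path
  ... | inj₁ (r′ , r′↭ , path′) =
    inj₁ (b ∷ r′ , ↭-trans (↭-prep b r′↭) (↭-swap b v ↭-refl) , ab ∷ path′)
  ... | inj₂ sparse with adjacentToBoth⊎atMostOne v a b
  ...   | inj₁ (va , vb)   = inj₁ (v ∷ b ∷ r , ↭-refl , adj-sym va ∷ vb ∷ path)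
  ...   | inj₂ atMostOne = inj₂ (extend (𝟙 (adj? v a)) (𝟙 (adj? v b)) _ _ _ sparse atMostOne)
    where
    extend : ∀ ia ib iz d n → 2 * d + ib + iz ≤ suc n → ia + ib ≤ 1 →
             2 * (ib + d) + ia + iz ≤ suc (suc n)
    extend ia ib iz d n h s = begin
      2 * (ib + d) + ia + iz       ≡⟨ regroup ia ib iz d ⟩
      (2 * d + ib + iz) + (ia + ib) ≤⟨ +-mono-≤ h s ⟩
      suc n + 1                    ≡⟨ +-comm (suc n) 1 ⟩
      suc (suc n)                  ∎
      where
      open ≤-Reasoning
      regroup : ∀ ia ib iz d → 2 * (ib + d) + ia + iz ≡ (2 * d + ib + iz) + (ia + ib)
      regroup = solve-∀

  HamiltonCycle-∷ : HamiltonCycle W → length W < 2 * degreeIn v W → HamiltonCycle (v ∷ W)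
  HamiltonCycle-∷ {W} {v} (cycle x xs spans closed) rich with insertInPath⊎sparse v x xs x closed
  ... | inj₁ (xs′ , xs′↭ , closed′) = cycle x xs′ spans′ closed′
    where
    spans′ : x ∷ xs′ ↭ v ∷ W
    spans′ = ↭-trans (↭-prep x xs′↭) (↭-trans (↭-swap x v ↭-refl) (↭-prep v spans))
  ... | inj₂ sparse = ⊥-elim (<-irrefl refl (≤-trans long (≤-trans (≤-reflexive (regroup i d)) sparse)))
    where
    i = 𝟙 (adj? v x)
    d = degreeIn v xs
    long : suc (suc (length xs)) ≤ 2 * (i + d)
    long = subst₂ (λ n e → suc n ≤ 2 * e) (sym (↭-length spans)) (sym (degreeIn-↭ spans)) rich
    regroup : ∀ i d → 2 * (i + d) ≡ 2 * d + i + i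
    regroup = solve-∀

  Complete : List A → Set
  Complete V = ∀ {u w} → u ∈ V → w ∈ V → u ≢ w → Adj u w

  NonAdjacentPair : List A → Set
  NonAdjacentPair V = ∃₂ λ u w → u ∈ V × w ∈ V × u ≢ w × ¬ Adj u w

  nonAdjacentPair⊎complete : ∀ V → NonAdjacentPair V ⊎ Complete V
  nonAdjacentPair⊎complete V with any? (λ u → any? (λ w → ¬? (u ≟ w) ×-dec ¬? (adj? u w)) V) V
  ... | yes pair with u , u∈ , pair′ ← find pair with w , w∈ , (u≢w , ¬uw) ← find pair′ =
    inj₁ (u , w , u∈ , w∈ , u≢w , ¬uw)
  ... | no noPair = inj₂ complete
    where
    complete : Complete V
    complete {u} {w} u∈ w∈ u≢w with adj? u w
    ... | yes uw = uw
    ... | no ¬uw = ⊥-elim (noPair (lose u∈ (lose w∈ (u≢w , ¬uw))))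

  complete⇒Linked : Complete V → Unique U → U ⊆ V → Linked Adj U
  complete⇒Linked complete []                    _    = Linked.[]
  complete⇒Linked complete (_ ∷ [])              _    = [-]
  complete⇒Linked complete ((u≢w ∷ _) ∷ unique@(_ ∷ _)) U⊆V =
    complete (U⊆V (here refl)) (U⊆V (there (here refl))) u≢w
    ∷ complete⇒Linked complete unique (λ x∈ → U⊆V (there x∈))

  complete⇒HamiltonCycle : Complete (u ∷ w ∷ W) → Unique (u ∷ w ∷ W) → HamiltonCycle (u ∷ w ∷ W)
  complete⇒HamiltonCycle {u} {w} {W} complete unique@((u≢w ∷ _) ∷ _) =
    cycle u (w ∷ W) ↭-refl
      (complete (here refl) (there (here refl)) u≢w
       ∷ complete⇒Linked complete (Unique-resp-↭ rotate unique) (∈-resp-↭ (↭-sym rotate)))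
    where
    rotate : u ∷ w ∷ W ↭ w ∷ W ++ [ u ]
    rotate = ∷↭∷ʳ u (w ∷ W)

  -- When length V ≡ 3 + k, this says that V spans at least C(2 + k, 2) + 2 edges.
  Dense : ℕ → List A → Set
  Dense k V = (2 + k) * (1 + k) + 4 ≤ adjacentPairs V

  nonAdjacent-degrees : ∀ k → length V ≡ 3 + k → Dense k V →
    u ∈ V → w ∈ V → u ≢ w → ¬ Adj u w →
    3 + k ≤ degreeIn u V + degreeIn w V × degreeIn u V ≤ 1 + k × degreeIn w V ≤ 1 + k
  nonAdjacent-degrees {V} {u} {w} k |V| dense u∈ w∈ u≢w ¬uw
    with Z , u∷w∷Z↭V ← ∈₂⇒∷∷↭ u∈ w∈ u≢w =
    subst₂ (λ a b → 3 + k ≤ a + b) (sym deg-u) (sym deg-w) (degreeSum {degreeIn u Z} {degreeIn w Z} dense′ pairsZ) ,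
    subst₂ _≤_ (sym deg-u) |Z| (degreeIn≤length u Z) ,
    subst₂ _≤_ (sym deg-w) |Z| (degreeIn≤length w Z)
    where
    |Z| : length Z ≡ 1 + k
    |Z| = suc-injective (suc-injective (trans (↭-length u∷w∷Z↭V) |V|))
    deg-u : degreeIn u V ≡ degreeIn u Z
    deg-u = trans (sym (degreeIn-↭ u∷w∷Z↭V))
                  (trans (degreeIn-self u (w ∷ Z)) (degreeIn-nonadjacent Z ¬uw))
    deg-w : degreeIn w V ≡ degreeIn w Z
    deg-w = trans (sym (degreeIn-↭ u∷w∷Z↭V))
                  (trans (degreeIn-nonadjacent (w ∷ Z) (λ wu → ¬uw (adj-sym wu))) (degreeIn-self w Z))
    pairs : adjacentPairs V ≡ 2 * degreeIn u Z + (2 * degreeIn w Z + adjacentPairs Z)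
    pairs = trans (sym (adjacentPairs-↭ u∷w∷Z↭V))
                  (trans (adjacentPairs-∷ u (w ∷ Z))
                         (cong₂ (λ d p → 2 * d + p) (degreeIn-nonadjacent Z ¬uw) (adjacentPairs-∷ w Z)))
    dense′ : (2 + k) * (1 + k) + 4 ≤ 2 * degreeIn u Z + (2 * degreeIn w Z + adjacentPairs Z)
    dense′ = ≤-trans dense (≤-reflexive pairs)
    pairsZ : adjacentPairs Z + (1 + k) ≤ (1 + k) * (1 + k)
    pairsZ = subst (λ n → adjacentPairs Z + n ≤ n * n) |Z| (adjacentPairs+length≤length² Z)
    degreeSum : ∀ {a b p} → (2 + k) * (1 + k) + 4 ≤ 2 * a + (2 * b + p) →
                p + (1 + k) ≤ (1 + k) * (1 + k) → 3 + k ≤ a + b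
    degreeSum {a} {b} {p} h₁ h₂ = *-cancelˡ-≤ 2 (+-cancelˡ-≤ ((1 + k) * (1 + k) + p) _ _ (begin
      (1 + k) * (1 + k) + p + 2 * (3 + k)       ≡⟨ regroup₁ k p ⟩
      (2 + k) * (1 + k) + 4 + (p + (1 + k))     ≤⟨ +-mono-≤ h₁ h₂ ⟩
      2 * a + (2 * b + p) + (1 + k) * (1 + k)   ≡⟨ regroup₂ k a b p ⟩
      (1 + k) * (1 + k) + p + 2 * (a + b)       ∎))
      where
      open ≤-Reasoning
      regroup₁ : ∀ k p → (1 + k) * (1 + k) + p + 2 * (3 + k) ≡ (2 + k) * (1 + k) + 4 + (p + (1 + k))
      regroup₁ = solve-∀
      regroup₂ : ∀ k a b p → 2 * a + (2 * b + p) + (1 + k) * (1 + k) ≡ (1 + k) * (1 + k) + p + 2 * (a + b)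
      regroup₂ = solve-∀

  Dense-remove : ∀ k → v ∷ W ↭ V → Dense (suc k) V → degreeIn v V ≤ 2 + k → Dense k W
  Dense-remove {v} {W} {V} k v∷W↭V dense poor = +-cancelˡ-≤ (2 * degreeIn v W) _ _ (begin
    2 * degreeIn v W + ((2 + k) * (1 + k) + 4) ≤⟨ +-monoˡ-≤ _ (*-monoʳ-≤ 2 poor′) ⟩
    2 * (2 + k) + ((2 + k) * (1 + k) + 4)      ≡⟨ regroup k ⟩
    (3 + k) * (2 + k) + 4                      ≤⟨ dense ⟩
    adjacentPairs V                            ≡⟨ adjacentPairs-↭ (↭-sym v∷W↭V) ⟩
    adjacentPairs (v ∷ W)                      ≡⟨ adjacentPairs-∷ v W ⟩
    2 * degreeIn v W + adjacentPairs W         ∎)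
    where
    open ≤-Reasoning
    poor′ : degreeIn v W ≤ 2 + k
    poor′ = subst (_≤ 2 + k) (trans (sym (degreeIn-↭ v∷W↭V)) (degreeIn-self v W)) poor
    regroup : ∀ k → 2 * (2 + k) + ((2 + k) * (1 + k) + 4) ≡ (3 + k) * (2 + k) + 4
    regroup = solve-∀

  mutual
    hamiltonian : ∀ {V} k → Unique V → length V ≡ 3 + k → Dense k V → HamiltonCycle V
    hamiltonian {[]}         k _ () _
    hamiltonian {_ ∷ []}     k _ () _
    hamiltonian {u ∷ w ∷ W} k unique |V| dense with nonAdjacentPair⊎complete (u ∷ w ∷ W)
    ... | inj₂ complete = complete⇒HamiltonCycle complete unique
    ... | inj₁ pair     = hamiltonian-nonComplete k unique |V| dense pair

    hamiltonian-nonComplete : ∀ {V} k → Unique V → length V ≡ 3 + k → Dense k V →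
                              NonAdjacentPair V → HamiltonCycle V
    hamiltonian-nonComplete {V} k unique |V| dense (u , w , u∈ , w∈ , u≢w , ¬uw)
      with nonAdjacent-degrees k |V| dense u∈ w∈ u≢w ¬uw
    hamiltonian-nonComplete zero    _ _ _ _ | many , poor-u , poor-w =
      ⊥-elim (<-irrefl refl (≤-trans many (+-mono-≤ poor-u poor-w)))
    hamiltonian-nonComplete {V} (suc k) unique |V| dense (u , w , u∈ , w∈ , _) | many , poor-u , poor-w
      with ≤-total (degreeIn w V) (degreeIn u V)
    ... | inj₁ w≤u = hamiltonian-insert k unique |V| dense u∈ (≤-trans many (n≤m⇒m+n≤2*m w≤u)) poor-u
    ... | inj₂ u≤w = hamiltonian-insert k unique |V| dense w∈
                       (≤-trans many (≤-trans (≤-reflexive (+-comm (degreeIn u V) _)) (n≤m⇒m+n≤2*m u≤w))) poor-w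

    hamiltonian-insert : ∀ {V v} k → Unique V → length V ≡ 4 + k → Dense (suc k) V →
                         v ∈ V → 4 + k ≤ 2 * degreeIn v V → degreeIn v V ≤ 2 + k → HamiltonCycle V
    hamiltonian-insert {V} {v} k unique |V| dense v∈ rich poor with W , v∷W↭V ← ∈⇒∷↭ v∈ =
      HamiltonCycle-resp-↭ v∷W↭V
        (HamiltonCycle-∷ (hamiltonian k uniqueW |W| (Dense-remove k v∷W↭V dense poor)) richW)
      where
      |W| : length W ≡ 3 + k
      |W| = suc-injective (trans (↭-length v∷W↭V) |V|)
      uniqueW : Unique W
      uniqueW with _ ∷ uniqueW ← Unique-resp-↭ (↭-sym v∷W↭V) unique = uniqueW
      richW : suc (length W) ≤ 2 * degreeIn v W
      richW = subst₂ (λ n d → n ≤ 2 * d) (cong suc (sym |W|))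
                (trans (sym (degreeIn-↭ v∷W↭V)) (degreeIn-self v W)) rich

orient : ∀ {n} → Fin n → Fin n → Edge n
orient a b with a Fin.<? b
... | yes _ = (a , b)
... | no _  = (b , a)

orient-cases : ∀ {n} (a b : Fin n) → orient a b ≡ (a , b) ⊎ orient a b ≡ (b , a)
orient-cases a b with a Fin.<? b
... | yes _ = inj₁ refl
... | no _  = inj₂ refl

orient-injective : ∀ {n} {a b c d : Fin n} → orient a b ≡ orient c d → (a ≡ c × b ≡ d) ⊎ (a ≡ d × b ≡ c)
orient-injective {a = a} {b} {c} {d} eq with orient-cases a b | orient-cases c d
... | inj₁ e₁ | inj₁ e₂ = inj₁ (,-injective (trans (sym e₁) (trans eq e₂)))
... | inj₁ e₁ | inj₂ e₂ = inj₂ (,-injective (trans (sym e₁) (trans eq e₂)))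
... | inj₂ e₁ | inj₁ e₂ = inj₂ (swap (,-injective (trans (sym e₁) (trans eq e₂))))
... | inj₂ e₁ | inj₂ e₂ = inj₁ (swap (,-injective (trans (sym e₁) (trans eq e₂))))

module _ {n : ℕ} where

  open Counting (Fin._≟_ {n})

  edgesAlong : List (Fin n) → List (Edge n)
  edgesAlong []          = []
  edgesAlong (_ ∷ [])    = []
  edgesAlong (a ∷ b ∷ r) = orient a b ∷ edgesAlong (b ∷ r)

  length-edgesAlong : ∀ a r → length (edgesAlong (a ∷ r)) ≡ length r
  length-edgesAlong a []      = refl
  length-edgesAlong a (b ∷ r) = cong suc (length-edgesAlong b r)

  orient∈edgesAlong : ∀ {a b} L → orient a b ∈ edgesAlong L → a ∈ L × b ∈ L
  orient∈edgesAlong (c ∷ d ∷ r) (here eq) with orient-injective eq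
  ... | inj₁ (refl , refl) = here refl , there (here refl)
  ... | inj₂ (refl , refl) = there (here refl) , here refl
  orient∈edgesAlong (c ∷ d ∷ r) (there e∈) with orient∈edgesAlong (d ∷ r) e∈
  ... | a∈ , b∈ = there a∈ , there b∈

  edgesAlong-unique : ∀ {L} → Unique L → Unique (edgesAlong L)
  edgesAlong-unique {[]}        _ = []
  edgesAlong-unique {_ ∷ []}    _ = []
  edgesAlong-unique {a ∷ b ∷ r} unique@(_ ∷ unique′) =
    ¬Any⇒All¬ _ (λ ab∈ → Unique[x∷xs]⇒x∉xs unique (proj₁ (orient∈edgesAlong (b ∷ r) ab∈)))
    ∷ edgesAlong-unique unique′

  closedWalk-unique : ∀ {x y z zs} → Unique (x ∷ y ∷ z ∷ zs) →
                      Unique (edgesAlong (x ∷ y ∷ z ∷ zs ++ [ x ]))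
  closedWalk-unique {x} {y} {z} {zs} unique = ¬Any⇒All¬ _ xy∉ ∷ edgesAlong-unique unique′
    where
    unique′ : Unique (y ∷ z ∷ zs ++ [ x ])
    unique′ = Unique-resp-↭ (∷↭∷ʳ x (y ∷ z ∷ zs)) unique
    xy∉ : orient x y ∉ orient y z ∷ edgesAlong (z ∷ zs ++ [ x ])
    xy∉ (here eq) with orient-injective eq
    ... | inj₁ (x≡y , _) = Unique[x∷xs]⇒x∉xs unique (here x≡y)
    ... | inj₂ (x≡z , _) = Unique[x∷xs]⇒x∉xs unique (there (here x≡z))
    xy∉ (there xy∈) = Unique[x∷xs]⇒x∉xs unique′ (proj₂ (orient∈edgesAlong (z ∷ zs ++ [ x ]) xy∈))

  deg-∷≤ : ∀ (v a b : Fin n) S → deg v ((a , b) ∷ S) ≤ 𝟙 (v Fin.≟ a) + 𝟙 (v Fin.≟ b) + deg v S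
  deg-∷≤ v a b S with v Fin.≟ a | v Fin.≟ b
  ... | yes _ | yes _ = n≤1+n _
  ... | yes _ | no _  = ≤-refl
  ... | no _  | yes _ = ≤-refl
  ... | no _  | no _  = ≤-refl

  deg-∷ : ∀ (v : Fin n) {a b} S → a ≢ b → deg v ((a , b) ∷ S) ≡ 𝟙 (v Fin.≟ a) + 𝟙 (v Fin.≟ b) + deg v S
  deg-∷ v {a} {b} S a≢b with v Fin.≟ a | v Fin.≟ b
  ... | yes refl | yes refl = ⊥-elim (a≢b refl)
  ... | yes _    | no _     = refl
  ... | no _     | yes _    = refl
  ... | no _     | no _     = refl

  deg-orient-∷≤ : ∀ (v a b : Fin n) S → deg v (orient a b ∷ S) ≤ 𝟙 (v Fin.≟ a) + 𝟙 (v Fin.≟ b) + deg v S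
  deg-orient-∷≤ v a b S with orient a b | orient-cases a b
  ... | _ | inj₁ refl = deg-∷≤ v a b S
  ... | _ | inj₂ refl =
    subst (deg v ((b , a) ∷ S) ≤_) (cong (_+ deg v S) (+-comm (𝟙 (v Fin.≟ b)) _)) (deg-∷≤ v b a S)

  -- Each occurrence of v on the walk lies on at most two of its edges, and on only one at an end.
  deg-edgesAlong : ∀ (v a : Fin n) L z →
    deg v (edgesAlong (a ∷ L ++ [ z ])) + 𝟙 (v Fin.≟ a) + 𝟙 (v Fin.≟ z) ≤ 2 * occurrences v (a ∷ L ++ [ z ])
  deg-edgesAlong v a [] z = begin
    deg v (orient a z ∷ []) + i + j ≤⟨ +-monoˡ-≤ j (+-monoˡ-≤ i (deg-orient-∷≤ v a z [])) ⟩
    i + j + 0 + i + j              ≡⟨ regroup i j ⟩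
    2 * (i + (j + 0))              ∎
    where
    open ≤-Reasoning
    i = 𝟙 (v Fin.≟ a)
    j = 𝟙 (v Fin.≟ z)
    regroup : ∀ i j → i + j + 0 + i + j ≡ 2 * (i + (j + 0))
    regroup = solve-∀
  deg-edgesAlong v a (b ∷ L) z = begin
    deg v (orient a b ∷ E) + i + j       ≤⟨ +-monoˡ-≤ j (+-monoˡ-≤ i (deg-orient-∷≤ v a b E)) ⟩
    i + 𝟙 (v Fin.≟ b) + deg v E + i + j ≡⟨ regroup i (𝟙 (v Fin.≟ b)) (deg v E) j ⟩
    2 * i + (deg v E + 𝟙 (v Fin.≟ b) + j) ≤⟨ +-monoʳ-≤ (2 * i) (deg-edgesAlong v b L z) ⟩
    2 * i + 2 * occurrences v (b ∷ L ++ [ z ]) ≡⟨ *-distribˡ-+ 2 i _ ⟨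
    2 * occurrences v (a ∷ b ∷ L ++ [ z ]) ∎
    where
    open ≤-Reasoning
    E = edgesAlong (b ∷ L ++ [ z ])
    i = 𝟙 (v Fin.≟ a)
    j = 𝟙 (v Fin.≟ z)
    regroup : ∀ i k d j → i + k + d + i + j ≡ 2 * i + (d + k + j)
    regroup = solve-∀

  deg-closedWalk≤2 : ∀ {x xs} (v : Fin n) → x ∷ xs ↭ allFin n → deg v (edgesAlong (x ∷ xs ++ [ x ])) ≤ 2
  deg-closedWalk≤2 {x} {xs} v spans = +-cancelʳ-≤ (i + i) _ 2 (begin
    d + (i + i)                              ≡⟨ +-assoc d i i ⟨
    d + i + i                                ≤⟨ deg-edgesAlong v x xs x ⟩
    2 * occurrences v (x ∷ xs ++ [ x ])      ≡⟨ cong (2 *_) (∑-++ {f = λ y → 𝟙 (v Fin.≟ y)} (x ∷ xs) [ x ]) ⟩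
    2 * (occurrences v (x ∷ xs) + (i + 0))   ≡⟨ cong (λ o → 2 * (o + (i + 0))) once ⟩
    2 * (1 + (i + 0))                        ≡⟨ regroup i ⟩
    2 + (i + i)                              ∎)
    where
    open ≤-Reasoning
    d = deg v (edgesAlong (x ∷ xs ++ [ x ]))
    i = 𝟙 (v Fin.≟ x)
    once : occurrences v (x ∷ xs) ≡ 1
    once = trans (∑-↭ spans) (occurrences-unique (allFin⁺ n) (∈-allFin v))
    regroup : ∀ i → 2 * (1 + (i + 0)) ≡ 2 + (i + i)
    regroup = solve-∀

  handshake : ∀ S → All (λ e → proj₁ e ≢ proj₂ e) S → ∑[ v ∈ allFin n ] deg v S ≡ 2 * length S
  handshake []            _                = ∑-zero (allFin n)
  handshake ((a , b) ∷ S) (a≢b ∷ loopless) = begin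
    ∑[ v ∈ V ] deg v ((a , b) ∷ S)                          ≡⟨ ∑-cong V (λ {v} _ → deg-∷ v S a≢b) ⟩
    ∑[ v ∈ V ] (𝟙 (v Fin.≟ a) + 𝟙 (v Fin.≟ b) + deg v S)    ≡⟨ ∑-+ V ⟩
    ∑[ v ∈ V ] (𝟙 (v Fin.≟ a) + 𝟙 (v Fin.≟ b)) + ∑[ v ∈ V ] deg v S
      ≡⟨ cong₂ _+_ (trans (∑-+ V) (cong₂ _+_ (once a) (once b))) (handshake S loopless) ⟩
    2 + 2 * length S                                        ≡⟨ *-distribˡ-+ 2 1 (length S) ⟨
    2 * length ((a , b) ∷ S)                                ∎
    where
    open ≡-Reasoning
    V = allFin n
    once : ∀ a → ∑[ v ∈ V ] 𝟙 (v Fin.≟ a) ≡ 1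
    once a = trans (∑-cong V (λ {v} _ → 𝟙-⇔ (v Fin.≟ a) (a Fin.≟ v) sym sym))
                   (occurrences-unique (allFin⁺ n) (∈-allFin a))

-- The upper bound

length-allFin : ∀ n → length (allFin n) ≡ n
length-allFin n = length-tabulate {n = n} (λ i → i)

module _ {n : ℕ} (G : Graph n) where

  _≟ₑ_ : DecidableEquality (Edge n)
  _≟ₑ_ = ≡-dec Fin._≟_ Fin._≟_

  open DecMembership _≟ₑ_ using (_∈?_)
  open Counting _≟ₑ_ using (∑𝟙∈≡length)

  Adjacent : Fin n → Fin n → Set
  Adjacent u v = (u , v) ∈ edges G ⊎ (v , u) ∈ edges G

  adjacent? : ∀ u v → Dec (Adjacent u v)
  adjacent? u v = ((u , v) ∈? edges G) ⊎-dec ((v , u) ∈? edges G)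

  adjacent-sym : ∀ {u v} → Adjacent u v → Adjacent v u
  adjacent-sym = Sum.swap

  edge-ordered : ∀ {a b} → (a , b) ∈ edges G → a <ᶠ b
  edge-ordered = All.lookup (ordered G)

  edge-antisym : ∀ {a b} → ¬ ((a , b) ∈ edges G × (b , a) ∈ edges G)
  edge-antisym (ab∈ , ba∈) = Fin.<-asym (edge-ordered ab∈) (edge-ordered ba∈)

  adjacent-irrefl : ∀ {v} → ¬ Adjacent v v
  adjacent-irrefl (inj₁ vv∈) = Fin.<-irrefl refl (edge-ordered vv∈)
  adjacent-irrefl (inj₂ vv∈) = Fin.<-irrefl refl (edge-ordered vv∈)

  open Hamiltonicity Fin._≟_ adjacent? adjacent-sym adjacent-irrefl public

  adjacentPairs-allFin : adjacentPairs (allFin n) ≡ 2 * numEdges G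
  adjacentPairs-allFin = begin
    ∑[ x ∈ V ] ∑[ y ∈ V ] 𝟙 (adjacent? x y)
      ≡⟨ ∑-cong V (λ {x} _ → ∑-cong V (λ {y} _ → 𝟙-⊎ ((x , y) ∈? E) ((y , x) ∈? E) edge-antisym)) ⟨
    ∑[ x ∈ V ] ∑[ y ∈ V ] (𝟙 ((x , y) ∈? E) + 𝟙 ((y , x) ∈? E))
      ≡⟨ trans (∑-cong V (λ _ → ∑-+ V)) (∑-+ V) ⟩
    ∑[ x ∈ V ] ∑[ y ∈ V ] 𝟙 ((x , y) ∈? E) + ∑[ x ∈ V ] ∑[ y ∈ V ] 𝟙 ((y , x) ∈? E)
      ≡⟨ cong (∑[ x ∈ V ] ∑[ y ∈ V ] 𝟙 ((x , y) ∈? E) +_) (∑-swap (λ x y → 𝟙 ((y , x) ∈? E)) V V) ⟩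
    ∑[ x ∈ V ] ∑[ y ∈ V ] 𝟙 ((x , y) ∈? E) + ∑[ y ∈ V ] ∑[ x ∈ V ] 𝟙 ((y , x) ∈? E)
      ≡⟨ cong₂ _+_ countEdges countEdges ⟩
    numEdges G + numEdges G
      ≡⟨ cong (numEdges G +_) (+-identityʳ (numEdges G)) ⟨
    2 * numEdges G ∎
    where
    open ≡-Reasoning
    V = allFin n
    E = edges G
    countEdges : ∑[ x ∈ V ] ∑[ y ∈ V ] 𝟙 ((x , y) ∈? E) ≡ numEdges G
    countEdges = trans (sym (∑-cartesianProduct (λ e → 𝟙 (e ∈? E)) V V))
      (∑𝟙∈≡length (cartesianProduct V V) (cartesianProduct⁺ (allFin⁺ n) (allFin⁺ n)) (distinct G)
        (λ {(a , b)} _ → ∈-cartesianProduct⁺ (∈-allFin a) (∈-allFin b)))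

  orient∈edges : ∀ {a b} → Adjacent a b → orient a b ∈ edges G
  orient∈edges {a} {b} ab with a Fin.<? b | ab
  ... | yes _   | inj₁ ab∈ = ab∈
  ... | yes a<b | inj₂ ba∈ = ⊥-elim (Fin.<-asym a<b (edge-ordered ba∈))
  ... | no a≮b  | inj₁ ab∈ = ⊥-elim (a≮b (edge-ordered ab∈))
  ... | no _    | inj₂ ba∈ = ba∈

  edgesAlong⊆edges : ∀ {L} → Linked Adjacent L → edgesAlong L ⊆ edges G
  edgesAlong⊆edges (ab ∷ path) (here refl) = orient∈edges ab
  edgesAlong⊆edges (ab ∷ path) (there e∈)  = edgesAlong⊆edges path e∈

  length-spanning : ∀ {x xs} → x ∷ xs ↭ allFin n → n ≡ length (x ∷ xs)
  length-spanning spans = trans (sym (length-allFin n)) (sym (↭-length spans))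

  HamiltonCycle⇒¬HasProperty3 : 3 ≤ n → HamiltonCycle (allFin n) → ¬ HasProperty3 n G
  HamiltonCycle⇒¬HasProperty3 3≤n (cycle x [] spans _) _ with ≤-trans 3≤n (≤-reflexive (length-spanning spans))
  ... | s≤s ()
  HamiltonCycle⇒¬HasProperty3 3≤n (cycle x (_ ∷ []) spans _) _ with ≤-trans 3≤n (≤-reflexive (length-spanning spans))
  ... | s≤s (s≤s ())
  HamiltonCycle⇒¬HasProperty3 _ (cycle x xs@(_ ∷ _ ∷ _) spans closed) property3 =
    let v , 3≤deg = property3 S unique (edgesAlong⊆edges closed) |S|
    in <-irrefl refl (≤-trans 3≤deg (deg-closedWalk≤2 v spans))
    where
    S = edgesAlong (x ∷ xs ++ [ x ])
    unique : Unique S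
    unique = closedWalk-unique (Unique-resp-↭ (↭-sym spans) (allFin⁺ n))
    |S| : length S ≡ n
    |S| = begin
      length (edgesAlong (x ∷ xs ++ [ x ])) ≡⟨ length-edgesAlong x (xs ++ [ x ]) ⟩
      length (xs ++ [ x ])                  ≡⟨ length-++ xs ⟩
      length xs + 1                         ≡⟨ +-comm (length xs) 1 ⟩
      length (x ∷ xs)                       ≡⟨ length-spanning spans ⟨
      n                                     ∎
      where open ≡-Reasoning

2*[1+m]C2≡[1+m]*m : ∀ m → 2 * (suc m C 2) ≡ suc m * m
2*[1+m]C2≡[1+m]*m zero    = refl
2*[1+m]C2≡[1+m]*m (suc m) = begin
  2 * (suc (suc m) C 2)         ≡⟨ cong (2 *_) (nCk+nC[k+1]≡[n+1]C[k+1] (suc m) 1) ⟨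
  2 * (suc m C 1 + suc m C 2)   ≡⟨ cong (λ c → 2 * (c + suc m C 2)) (nC1≡n (suc m)) ⟩
  2 * (suc m + suc m C 2)       ≡⟨ *-distribˡ-+ 2 (suc m) _ ⟩
  2 * suc m + 2 * (suc m C 2)   ≡⟨ cong (2 * suc m +_) (2*[1+m]C2≡[1+m]*m m) ⟩
  2 * suc m + suc m * m         ≡⟨ regroup m ⟩
  suc (suc m) * suc m           ∎
  where
  open ≡-Reasoning
  regroup : ∀ m → 2 * suc m + suc m * m ≡ suc (suc m) * suc m
  regroup = solve-∀

HasProperty3⇒numEdges≤ : ∀ k (G : Graph (3 + k)) → HasProperty3 (3 + k) G → numEdges G ≤ (2 + k) C 2 + 1
HasProperty3⇒numEdges≤ k G property3 with numEdges G ≤? (2 + k) C 2 + 1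
... | yes fewEdges = fewEdges
... | no manyEdges =
  ⊥-elim (HamiltonCycle⇒¬HasProperty3 G (s≤s (s≤s (s≤s z≤n)))
            (hamiltonian G k (allFin⁺ _) (length-allFin _) dense) property3)
  where
  open ≤-Reasoning
  dense : Dense G k (allFin (3 + k))
  dense = begin
    (2 + k) * (1 + k) + 4                ≡⟨ cong (_+ 4) (2*[1+m]C2≡[1+m]*m (suc k)) ⟨
    2 * ((2 + k) C 2) + 4                ≡⟨ regroup ((2 + k) C 2) ⟩
    2 * suc ((2 + k) C 2 + 1)            ≤⟨ *-monoʳ-≤ 2 (≰⇒> manyEdges) ⟩
    2 * numEdges G                       ≡⟨ adjacentPairs-allFin G ⟨
    adjacentPairs G (allFin (3 + k))     ∎
    where
    regroup : ∀ c → 2 * c + 4 ≡ 2 * suc (c + 1)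
    regroup = solve-∀

-- The extremal graph

lift : ∀ {n} → Edge n → Edge (suc n)
lift (a , b) = (suc a , suc b)

lift-injective : ∀ {n} {e e′ : Edge n} → lift e ≡ lift e′ → e ≡ e′
lift-injective refl = refl

completeEdges : ∀ n → List (Edge n)
completeEdges zero    = []
completeEdges (suc n) = tabulate (λ j → (zero , suc j)) ++ map lift (completeEdges n)

length-completeEdges : ∀ n → length (completeEdges n) ≡ n C 2
length-completeEdges zero    = refl
length-completeEdges (suc n) = begin
  length (tabulate star ++ map lift (completeEdges n))        ≡⟨ length-++ (tabulate star) ⟩
  length (tabulate star) + length (map lift (completeEdges n)) ≡⟨ cong₂ _+_ (length-tabulate star) lifted ⟩
  n + n C 2                                                  ≡⟨ cong (_+ n C 2) (nC1≡n n) ⟨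
  n C 1 + n C 2                                              ≡⟨ nCk+nC[k+1]≡[n+1]C[k+1] n 1 ⟩
  suc n C 2                                                  ∎
  where
  open ≡-Reasoning
  star : Fin n → Edge (suc n)
  star j = (zero , suc j)
  lifted : length (map lift (completeEdges n)) ≡ n C 2
  lifted = trans (length-map lift (completeEdges n)) (length-completeEdges n)

completeEdges-ordered : ∀ n → All (λ e → proj₁ e <ᶠ proj₂ e) (completeEdges n)
completeEdges-ordered zero    = All.[]
completeEdges-ordered (suc n) =
  All.++⁺ (All.tabulate⁺ (λ _ → s≤s z≤n)) (All.map⁺ (All.map s≤s (completeEdges-ordered n)))

completeEdges-unique : ∀ n → Unique (completeEdges n)
completeEdges-unique zero    = []
completeEdges-unique (suc n) =
  Unique.++⁺ (Unique.tabulate⁺ (λ eq → Fin.suc-injective (cong proj₂ eq)))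
             (Unique.map⁺ lift-injective (completeEdges-unique n))
             star∉lifted
  where
  star∉lifted : Disjoint (tabulate (λ j → (zero , suc j))) (map lift (completeEdges n))
  star∉lifted (star∈ , lifted∈) with ∈-tabulate⁻ star∈ | ∈-map⁻ lift lifted∈
  ... | _ , refl | _ , _ , ()

pendantClique : ∀ n → Graph (2 + n)
pendantClique n = record
  { edges    = (zero , suc zero) ∷ map lift (completeEdges (suc n))
  ; ordered  = s≤s z≤n ∷ All.map⁺ (All.map s≤s (completeEdges-ordered (suc n)))
  ; distinct = ¬Any⇒All¬ _ pendant∉ ∷ Unique.map⁺ lift-injective (completeEdges-unique (suc n))
  }
  where
  pendant∉ : (zero , suc zero) ∉ map lift (completeEdges (suc n))
  pendant∉ pendant∈ with ∈-map⁻ lift pendant∈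
  ... | _ , _ , ()

numEdges-pendantClique : ∀ n → numEdges (pendantClique n) ≡ suc n C 2 + 1
numEdges-pendantClique n =
  trans (cong suc (trans (length-map lift (completeEdges (suc n))) (length-completeEdges (suc n)))) (+-comm 1 _)

deg-nonincident : ∀ {n} (v : Fin n) S → (∀ {a b} → (a , b) ∈ S → ¬ (v ≡ a ⊎ v ≡ b)) → deg v S ≡ 0
deg-nonincident v []            _    = refl
deg-nonincident v ((a , b) ∷ S) away with v Fin.≟ a | v Fin.≟ b
... | yes v≡a | _       = ⊥-elim (away (here refl) (inj₁ v≡a))
... | no _    | yes v≡b = ⊥-elim (away (here refl) (inj₂ v≡b))
... | no _    | no _    = deg-nonincident v S (λ e∈ → away (there e∈))

deg≤1 : ∀ {n} (v : Fin n) {e₀} S → Unique S →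
        (∀ {a b} → (a , b) ∈ S → v ≡ a ⊎ v ≡ b → (a , b) ≡ e₀) → deg v S ≤ 1
deg≤1 v []            _                   _    = z≤n
deg≤1 v ((a , b) ∷ S) (ab∉S ∷ unique) only with v Fin.≟ a | v Fin.≟ b
... | yes v≡a | _       = s≤s (≤-reflexive (deg-nonincident v S (λ cd∈ v∈cd →
  All.lookup ab∉S cd∈ (trans (only (here refl) (inj₁ v≡a)) (sym (only (there cd∈) v∈cd))))))
... | no _    | yes v≡b = s≤s (≤-reflexive (deg-nonincident v S (λ cd∈ v∈cd →
  All.lookup ab∉S cd∈ (trans (only (here refl) (inj₂ v≡b)) (sym (only (there cd∈) v∈cd))))))
... | no _    | no _    = deg≤1 v S unique (λ e∈ → only (there e∈))

deg-pendant≤1 : ∀ n {S} → Unique S → S ⊆ edges (pendantClique n) → deg zero S ≤ 1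
deg-pendant≤1 n {S} unique S⊆E = deg≤1 zero S unique pendant
  where
  pendant : ∀ {a b} → (a , b) ∈ S → zero ≡ a ⊎ zero ≡ b → (a , b) ≡ (zero , suc zero)
  pendant ab∈ at0 with S⊆E ab∈
  ... | here eq = eq
  ... | there lifted∈ with ∈-map⁻ lift lifted∈ | at0
  ...   | _ , _ , refl | inj₁ ()
  ...   | _ , _ , refl | inj₂ ()

pendantClique-hasProperty3 : ∀ n → HasProperty3 (2 + n) (pendantClique n)
pendantClique-hasProperty3 n S unique S⊆E |S| with any? (λ v → 3 ≤? deg v S) (allFin (2 + n))
... | yes high = let v , _ , 3≤deg = find high in v , 3≤deg
... | no ¬high = ⊥-elim (<-irrefl refl (begin-strict
  3 + 2 * n                        <⟨ n<1+n (3 + 2 * n) ⟩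
  4 + 2 * n                        ≡⟨ regroup₁ n ⟩
  2 * (2 + n)                      ≡⟨ cong (2 *_) |S| ⟨
  2 * length S                     ≡⟨ handshake S loopless ⟨
  ∑[ v ∈ allFin (2 + n) ] deg v S  ≤⟨ +-mono-≤ (deg-pendant≤1 n unique S⊆E) others ⟩
  1 + (1 + n) * 2                  ≡⟨ regroup₂ n ⟩
  3 + 2 * n                        ∎))
  where
  open ≤-Reasoning
  regroup₁ : ∀ n → 4 + 2 * n ≡ 2 * (2 + n)
  regroup₁ = solve-∀
  regroup₂ : ∀ n → 1 + (1 + n) * 2 ≡ 3 + 2 * n
  regroup₂ = solve-∀
  loopless : All (λ e → proj₁ e ≢ proj₂ e) S
  loopless = All.tabulate (λ e∈ eq → Fin.<-irrefl eq (All.lookup (ordered (pendantClique n)) (S⊆E e∈)))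
  nonzero : List (Fin (2 + n))
  nonzero = tabulate suc
  others : ∑[ v ∈ nonzero ] deg v S ≤ (1 + n) * 2
  deg≤2 : ∀ v → deg v S ≤ 2
  deg≤2 v = ≤-pred (≰⇒> (λ 3≤deg → ¬high (lose (∈-allFin v) 3≤deg)))
  others = begin
    ∑[ v ∈ nonzero ] deg v S ≤⟨ ∑-mono nonzero (λ {v} _ → deg≤2 v) ⟩
    ∑[ v ∈ nonzero ] 2       ≡⟨ ∑-const nonzero 2 ⟩
    length nonzero * 2       ≡⟨ cong (_* 2) (length-tabulate {n = 1 + n} suc) ⟩
    (1 + n) * 2              ∎

mainTheorem5 : (p : ℕ) → 3 ≤ p →
    (Σ (Graph p) (λ G → HasProperty3 p G × numEdges G ≡ ((p ∸ 1) C 2) + 1))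
    × ((G : Graph p) → HasProperty3 p G → numEdges G ≤ ((p ∸ 1) C 2) + 1)
mainTheorem5 (suc (suc (suc k))) _ =
  (pendantClique (suc k) , pendantClique-hasProperty3 (suc k) , numEdges-pendantClique (suc k)) ,
  HasProperty3⇒numEdges≤ k
mainTheorem5 (suc (suc zero)) (s≤s (s≤s ()))
mainTheorem5 (suc zero)       (s≤s ())
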